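{- For each $\alpha < \aleph_{m}$ $$\{ \langle u,c \rangle\in {\mathbb P} : \exists \beta ( \beta \in u \wedge \alpha < \beta) \}$$ is dense in $({\mathbb P},< )$.
   Context: Fix an integer $m\geq 1$. Fix a countable relational language $L\supseteq\{<\}$ and an expansion ${\cal M}$ of $\langle\aleph_m;<\rangle$ to $L$ such that for each $k<\omega$ and formula $\varphi$ with at most $k+1$ free variables there is $\psi$ with at most $k+2$ free variables such that for every $k$-tuple $\bar a$ from $\aleph_m$, $\psi(x,y,\bar a)$ well orders $\{b:{\cal M}\models\varphi(b,\bar a)\}$ in order type its cardinality. Write $b\,R_0\,\bar a$ if there is an $L$-formula $\varphi$ with ${\cal M}\models(\exists^{\leq\aleph_0}x)\varphi(x,\bar a)$ and ${\cal M}\models\varphi(b,\bar a)$. ${\mathbb R}=\{\langle u,c\rangle: u\in[\aleph_m]^{<\aleph_0},\ c:[u]^2\to\omega\}$. $p=\langle u,c\rangle\in\mathbb R$ is the amalgam of $p^0=\langle u^0,c^0\rangle$ and $p^1=\langle u^1,c^1\rangle$ if there are $h<\omega$ and increasing enumerations $u^0=\{i^0_0,\dots,i^0_h\}$, $u^1=\{i^1_0,\dots,i^1_h\}$ such that for $s<t\leq h$: $c^0(\{i^0_s,i^0_t\})=c^1(\{i^1_s,i^1_t\})$; $i^0_t\leq i^1_t$; $i^0_t\neq i^1_t$ implies $\neg\, i^1_t R_0 u^0$; $u=u^0\cup u^1$; $c\supseteq c^0\cup c^1$; pairs not in $[u^0]^2\cup[u^1]^2$ get colors outside $\mathrm{rng}(c^0)\cup\mathrm{rng}(c^1)$;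 and two distinct pairs share a color only if both lie in $[u^0]^2\cup[u^1]^2$. $q=\langle u^q,c^q\rangle$ is a one-point extension of $p=\langle u^p,c^p\rangle$ if $u^q=u^p\cup\{r\}$ with $r>u^p$, $c^p\subseteq c^q$, new pairs get colors not in $\mathrm{rng}(c^p)$, and two distinct pairs share a color only if both are in $\mathrm{dom}(c^p)$. ${\mathbb P}_0=\{\langle u,c\rangle\in\mathbb R:|u|=1\}$; ${\mathbb P}_{n+1}$ consists of ${\mathbb P}_n$, all amalgams of pairs from ${\mathbb P}_n$ and all one-point extensions of elements of ${\mathbb P}_n$; ${\mathbb P}=\bigcup_n{\mathbb P}_n$, ordered by $p\leq q$ iff $u^p\supseteq u^q$ and $c^p\supseteq c^q$. -}

module Defs where

open import Data.Nat using (ℕ; suc)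
open import Data.Fin using (Fin) renaming (_<_ to _<ᶠ_)
open import Data.Product using (Σ; _×_; ∃; ∃-syntax)
open import Data.Sum using (_⊎_)
open import Data.Empty using (⊥)
open import Relation.Nullary using (¬_)
open import Relation.Binary.PropositionalEquality using (_≡_; _≢_)
open import Relation.Binary.Structures using (IsStrictTotalOrder)
open import Induction.WellFounded using (WellFounded)
open import Function.Definitions using (Injective)
open import Function.Bundles using (_⇔_)

-- Abstract stand-in for the fixed setting: the ordinal ℵ_m (a well-ordered,
-- uncountable set without maximum) together with the relation R₀ between an
-- element and a finite tuple.
record Setting : Set₁ where
  field
    Car         : Set
    _<_         : Car → Car → Set
    isSTO       : IsStrictTotalOrder _≡_ _<_
    wellFounded : WellFounded _<_
    noMax       : ∀ a → ∃[ b ] (a < b)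
    uncountable : ¬ (Σ (Car → ℕ) λ f → Injective _≡_ _≡_ f)
    R₀          : Car → {k : ℕ} → (Fin k → Car) → Set

module Forcing (S : Setting) where
  open Setting S

  _≤ₐ_ : Car → Car → Set
  x ≤ₐ y = x < y ⊎ x ≡ y

  -- An element ⟨u,c⟩ of ℝ with |u| = n: u is given by its strictly increasing
  -- enumeration u 0 < ... < u (n-1); the colour of the pair {u s, u t}
  -- (s < t) is c s t (values of c at s ≥ t are irrelevant).
  record Cond (n : ℕ) : Set where
    field
      u    : Fin n → Car
      c    : Fin n → Fin n → ℕ
      incr : ∀ {s t} → s <ᶠ t → u s < u t
  open Cond public

  _∈u_ : ∀ {n} → Car → Cond n → Set
  x ∈u p = ∃[ s ] (u p s ≡ x)

  InPairs : ∀ {n} → Cond n → Car → Car → Set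
  InPairs p x y = ∃[ s ] ∃[ t ] (s <ᶠ t × u p s ≡ x × u p t ≡ y)

  HasCol : ∀ {n} → Cond n → Car → Car → ℕ → Set
  HasCol p x y k = ∃[ s ] ∃[ t ] (s <ᶠ t × u p s ≡ x × u p t ≡ y × c p s t ≡ k)

  InRng : ∀ {n} → Cond n → ℕ → Set
  InRng p k = ∃[ s ] ∃[ t ] (s <ᶠ t × c p s t ≡ k)

  ColSub : ∀ {m n} → Cond m → Cond n → Set
  ColSub q p = ∀ s t → s <ᶠ t → HasCol p (u q s) (u q t) (c q s t)

  USub : ∀ {m n} → Cond m → Cond n → Set
  USub q p = ∀ s → u q s ∈u p

  _≤ₚ_ : ∀ {m n} → Cond m → Cond n → Set
  p ≤ₚ q = USub q p × ColSub q p

  record Amalgam {h k : ℕ} (p : Cond k) (p0 p1 : Cond (suc h)) : Set where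
    field
      sameCol   : ∀ s t → s <ᶠ t → c p0 s t ≡ c p1 s t
      below     : ∀ t → u p0 t ≤ₐ u p1 t
      notR₀     : ∀ t → u p0 t ≢ u p1 t → ¬ R₀ (u p1 t) (u p0)
      union     : ∀ x → x ∈u p ⇔ (x ∈u p0 ⊎ x ∈u p1)
      ext0      : ColSub p0 p
      ext1      : ColSub p1 p
      freshCol  : ∀ s t → s <ᶠ t →
                  ¬ InPairs p0 (u p s) (u p t) → ¬ InPairs p1 (u p s) (u p t) →
                  ¬ InRng p0 (c p s t) × ¬ InRng p1 (c p s t)
      sharedOld : ∀ s t s' t' → s <ᶠ t → s' <ᶠ t' → ¬ (s ≡ s' × t ≡ t') →
                  c p s t ≡ c p s' t' →
                  (InPairs p0 (u p s) (u p t) ⊎ InPairs p1 (u p s) (u p t)) ×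
                  (InPairs p0 (u p s') (u p t') ⊎ InPairs p1 (u p s') (u p t'))

  record OneExt {n : ℕ} (q : Cond (suc n)) (p : Cond n) : Set where
    field
      r         : Car
      union     : ∀ x → x ∈u q ⇔ (x ∈u p ⊎ x ≡ r)
      above     : ∀ s → u p s < r
      extCol    : ColSub p q
      freshCol  : ∀ s t → s <ᶠ t → ¬ InPairs p (u q s) (u q t) → ¬ InRng p (c q s t)
      sharedOld : ∀ s t s' t' → s <ᶠ t → s' <ᶠ t' → ¬ (s ≡ s' × t ≡ t') →
                  c q s t ≡ c q s' t' →
                  InPairs p (u q s) (u q t) × InPairs p (u q s') (u q t')

  -- membership in ℙ = ⋃ₙ ℙₙ (inductive closure)
  data InP : ∀ {n} → Cond n → Set where
    base  : (p : Cond 1) → InP p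
    amalg : ∀ {h k} {p0 p1 : Cond (suc h)} {p : Cond k} →
            InP p0 → InP p1 → Amalgam p p0 p1 → InP p
    ext   : ∀ {n} {p : Cond n} {q : Cond (suc n)} →
            InP p → OneExt q p → InP q

  Dense : (∀ {n} → Cond n → Set) → Set
  Dense D = ∀ {n} (p : Cond n) → InP p →
            ∃[ k ] Σ (Cond k) λ q → InP q × D q × q ≤ₚ p

  HasAbove : Car → ∀ {n} → Cond n → Set
  HasAbove α q = ∃[ s ] (α < u q s)

{-# OPTIONS --safe #-}
-- Given p, pick r above α and above every point of u p (ℵ_m has no largest element) and
-- adjoin r to p, giving every new pair {x, r} its own colour, larger than all colours of p.
-- The result is a one-point extension of p, hence lies in ℙ below p, and r > α lies in it.
module Submission where

open import Defs
open import Data.Nat as ℕ using (ℕ; zero; suc; _+_)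
import Data.Nat.Properties as ℕ
open import Data.Fin using (Fin; zero; suc; toℕ; inject₁; fromℕ) renaming (_<_ to _<ᶠ_)
open import Data.Fin.Properties using (toℕ-inject₁; ≤fromℕ; toℕ-injective)
open import Data.Fin.Relation.Unary.Top using (view; ‵fromℕ; ‵inject₁)
open import Data.Product using (_×_; ∃-syntax; _,_; proj₁; proj₂)
open import Data.Sum using (_⊎_; inj₁; inj₂)
open import Data.Empty using (⊥-elim)
open import Level using (0ℓ)
open import Relation.Nullary using (¬_)
open import Relation.Binary.Core using (Rel)
open import Relation.Binary.PropositionalEquality
open import Relation.Binary.Structures using (IsStrictTotalOrder)
open import Relation.Binary.Definitions using (tri<; tri≈; tri>)
open import Function using (_∘_)
open import Function.Bundles using (Equivalence; mk⇔)

module UpperBound {A : Set} {_<_ : Rel A 0ℓ}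
                  (sto : IsStrictTotalOrder _≡_ _<_) (noMax : ∀ a → ∃[ b ] (a < b)) where
  open IsStrictTotalOrder sto using (compare) renaming (trans to <-trans)

  upperBound : ∀ {n} (a : A) (f : Fin n → A) → ∃[ b ] (a < b × ∀ i → f i < b)
  upperBound {zero} a f = let b , a<b = noMax a in b , a<b , λ ()
  upperBound {suc n} a f with compare a (f zero)
  ... | tri< a<f₀ _ _ = let b , f₀<b , f<b = upperBound (f zero) (f ∘ suc) in
    b , <-trans a<f₀ f₀<b , λ { zero → f₀<b ; (suc i) → f<b i }
  ... | tri≈ _ refl _ = let b , a<b , f<b = upperBound a (f ∘ suc) in
    b , a<b , λ { zero → a<b ; (suc i) → f<b i }
  ... | tri> _ _ f₀<a = let b , a<b , f<b = upperBound a (f ∘ suc) in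
    b , a<b , λ { zero → <-trans f₀<a a<b ; (suc i) → f<b i }

  upperBound₂ : ∀ {m n} (a : A) (f : Fin m → Fin n → A) → ∃[ b ] (∀ s t → f s t < b)
  upperBound₂ a f =
    let b , _ , row<b = upperBound a (proj₁ ∘ rowBound) in
    b , λ s t → <-trans (proj₂ (proj₂ (rowBound s)) t) (row<b s)
    where
    rowBound : ∀ s → ∃[ b ] (a < b × ∀ t → f s t < b)
    rowBound s = upperBound a (f s)

snoc : ∀ {A : Set} {n} → (Fin n → A) → A → Fin (suc n) → A
snoc {n = zero}  f a _       = a
snoc {n = suc n} f a zero    = f zero
snoc {n = suc n} f a (suc i) = snoc (f ∘ suc) a i

snoc-inject₁ : ∀ {A : Set} {n} (f : Fin n → A) a i → snoc f a (inject₁ i) ≡ f i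
snoc-inject₁ f a zero    = refl
snoc-inject₁ f a (suc i) = snoc-inject₁ (f ∘ suc) a i

snoc-fromℕ : ∀ {A : Set} n (f : Fin n → A) a → snoc f a (fromℕ n) ≡ a
snoc-fromℕ zero    f a = refl
snoc-fromℕ (suc n) f a = snoc-fromℕ n (f ∘ suc) a

inject₁-mono-< : ∀ {n} {i j : Fin n} → i <ᶠ j → inject₁ i <ᶠ inject₁ j
inject₁-mono-< {i = i} {j} = subst₂ ℕ._<_ (sym (toℕ-inject₁ i)) (sym (toℕ-inject₁ j))

inject₁-cancel-< : ∀ {n} {i j : Fin n} → inject₁ i <ᶠ inject₁ j → i <ᶠ j
inject₁-cancel-< {i = i} {j} = subst₂ ℕ._<_ (toℕ-inject₁ i) (toℕ-inject₁ j)

fromℕ≮ : ∀ {n} (t : Fin (suc n)) → ¬ (fromℕ n <ᶠ t)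
fromℕ≮ t fromℕ<t = ℕ.<⇒≱ fromℕ<t (≤fromℕ t)

data PairView {n} : Fin (suc n) → Fin (suc n) → Set where
  old : ∀ {i j} → i <ᶠ j → PairView (inject₁ i) (inject₁ j)
  new : ∀ i → PairView (inject₁ i) (fromℕ n)

pairView : ∀ {n} {s t : Fin (suc n)} → s <ᶠ t → PairView s t
pairView {s = s} {t} s<t with view s | view t
... | ‵fromℕ     | _          = ⊥-elim (fromℕ≮ t s<t)
... | ‵inject₁ i | ‵inject₁ j = old (inject₁-cancel-< s<t)
... | ‵inject₁ i | ‵fromℕ     = new i

module OnePointExtension (S : Setting) where
  open Setting S
  open Forcing S

  oneExt⇒≤ₚ : ∀ {n} {q : Cond (suc n)} {p : Cond n} → OneExt q p → q ≤ₚ p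
  oneExt⇒≤ₚ {p = p} e = (λ s → Equivalence.from (union (u p s)) (inj₁ (s , refl))) , extCol
    where open OneExt e

  oneExt-r∈u : ∀ {n} {q : Cond (suc n)} {p : Cond n} (e : OneExt q p) → OneExt.r e ∈u q
  oneExt-r∈u e = Equivalence.from (union r) (inj₂ refl)
    where open OneExt e

  colourBound : ∀ {n} (p : Cond n) → ∃[ M ] (∀ s t → c p s t ℕ.< M)
  colourBound p = upperBound₂ 0 (c p)
    where open UpperBound ℕ.<-isStrictTotalOrder (λ m → suc m , ℕ.n<1+n m)

  module _ {n} (p : Cond n) (r : Car) (u<r : ∀ s → u p s < r) where
    private
      M : ℕ
      M = proj₁ (colourBound p)

      c<M : ∀ s t → c p s t ℕ.< M
      c<M = proj₂ (colourBound p)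

      u′ : Fin (suc n) → Car
      u′ = snoc (u p) r

      -- The entries c′ (fromℕ n) (inject₁ j) are junk: they sit below the diagonal.
      c′ : Fin (suc n) → Fin (suc n) → ℕ
      c′ s = snoc (λ j → snoc (λ i → c p i j) 0 s) (M + toℕ s)

      u′-old : ∀ i → u′ (inject₁ i) ≡ u p i
      u′-old = snoc-inject₁ (u p) r

      u′-new : u′ (fromℕ n) ≡ r
      u′-new = snoc-fromℕ n (u p) r

      c′-old : ∀ i j → c′ (inject₁ i) (inject₁ j) ≡ c p i j
      c′-old i j = trans (snoc-inject₁ _ _ j) (snoc-inject₁ _ _ i)

      c′-new : ∀ s → c′ s (fromℕ n) ≡ M + toℕ s
      c′-new s = snoc-fromℕ n _ _

      old≢new : ∀ i j (s : Fin (suc n)) → c p i j ≢ M + toℕ s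
      old≢new i j s eq = ℕ.m+n≮m M (toℕ s) (subst (ℕ._< M) eq (c<M i j))

      new-injective : ∀ {s s′ : Fin (suc n)} → M + toℕ s ≡ M + toℕ s′ → s ≡ s′
      new-injective eq = toℕ-injective (ℕ.+-cancelˡ-≡ M _ _ eq)

      oldPair : ∀ {i j} → i <ᶠ j → InPairs p (u′ (inject₁ i)) (u′ (inject₁ j))
      oldPair {i} {j} i<j = i , j , i<j , sym (u′-old i) , sym (u′-old j)

      u′-incr : ∀ {s t} → s <ᶠ t → u′ s < u′ t
      u′-incr s<t with pairView s<t
      ... | old {i} {j} i<j = subst₂ _<_ (sym (u′-old i)) (sym (u′-old j)) (incr p i<j)
      ... | new i           = subst₂ _<_ (sym (u′-old i)) (sym u′-new) (u<r i)

    extend : Cond (suc n)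
    extend = record { u = u′ ; c = c′ ; incr = u′-incr }

    extend-oneExt : OneExt extend p
    extend-oneExt = record
      { r         = r
      ; union     = λ x → mk⇔ (split x) (join x)
      ; above     = u<r
      ; extCol    = λ s t s<t → inject₁ s , inject₁ t , inject₁-mono-< s<t ,
                                u′-old s , u′-old t , c′-old s t
      ; freshCol  = freshCol
      ; sharedOld = sharedOld
      }
      where
      split : ∀ x → x ∈u extend → x ∈u p ⊎ x ≡ r
      split x (s , u′s≡x) with view s
      ... | ‵inject₁ i = inj₁ (i , trans (sym (u′-old i)) u′s≡x)
      ... | ‵fromℕ     = inj₂ (trans (sym u′s≡x) u′-new)

      join : ∀ x → x ∈u p ⊎ x ≡ r → x ∈u extend
      join x (inj₁ (i , us≡x)) = inject₁ i , trans (u′-old i) us≡x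
      join x (inj₂ refl)       = fromℕ n , u′-new

      freshCol : ∀ s t → s <ᶠ t → ¬ InPairs p (u′ s) (u′ t) → ¬ InRng p (c′ s t)
      freshCol s t s<t notOld with pairView s<t
      ... | old i<j = ⊥-elim (notOld (oldPair i<j))
      ... | new i   = λ (a , b , _ , eq) → old≢new a b (inject₁ i) (trans eq (c′-new _))

      sharedOld : ∀ s t s′ t′ → s <ᶠ t → s′ <ᶠ t′ → ¬ (s ≡ s′ × t ≡ t′) → c′ s t ≡ c′ s′ t′ →
                  InPairs p (u′ s) (u′ t) × InPairs p (u′ s′) (u′ t′)
      sharedOld s t s′ t′ s<t s′<t′ distinct eq with pairView s<t | pairView s′<t′
      ... | old i<j       | old i′<j′       = oldPair i<j , oldPair i′<j′
      ... | old {i} {j} _ | new _           =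
        ⊥-elim (old≢new i j _ (trans (sym (c′-old i j)) (trans eq (c′-new _))))
      ... | new _         | old {i′} {j′} _ =
        ⊥-elim (old≢new i′ j′ _ (trans (sym (c′-old i′ j′)) (trans (sym eq) (c′-new _))))
      ... | new _         | new _           =
        ⊥-elim (distinct (new-injective (trans (sym (c′-new _)) (trans eq (c′-new _))) , refl))

lemma3 : (S : Setting) (α : Setting.Car S) →
         Forcing.Dense S (Forcing.HasAbove S α)
lemma3 S α {n} p p∈ℙ =
  let r , α<r , u<r = upperBound α (u p)
      e             = extend-oneExt p r u<r
      s , u[s]≡r    = oneExt-r∈u e
  in suc n , extend p r u<r , ext p∈ℙ e ,
     (s , subst (α <_) (sym u[s]≡r) α<r) , oneExt⇒≤ₚ e
  where
  open Setting S
  open Forcing S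
  open OnePointExtension S
  open UpperBound isSTO noMax
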